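{- Let $r,s\ge 0$ be integers with $n=2(r+s)\ge 2$, and let $S\subseteq\mathbb{Z}_4^n$ be the set of vectors of type $(r,s,r,s)$. For $\mathbf{v}\in\mathbb{Z}_4^n$ of type $(t_0,t_1,t_2,t_3)$ let $\beta(\mathbf{v})=|\{\mathbf{b}\in S:\ \mathbf{b}\cdot\mathbf{v}\in\{0,2\}\}|$. Then $$\beta(\mathbf{v})=\frac{\binom{n}{r,s,r,s}}{\binom{n}{t_0+t_2}}\left(\tfrac12(x+y)^n+\tfrac12(x+y)^{2r}(x-y)^{2s}\right)[t_0+t_2,\,t_1+t_3].$$
   Context: For $\mathbf{v}\in\mathbb{Z}_4^n$, its type is $(t_0,t_1,t_2,t_3)$ where $t_k$ is the number of coordinates of $\mathbf{v}$ equal to $k$. $\mathbf{b}\cdot\mathbf{v}=\sum_k b_kv_k\in\mathbb{Z}_4$. $\binom{n}{r,s,r,s}=\frac{n!}{r!\,s!\,r!\,s!}$ is the multinomial coefficient. For a polynomial $f(x,y)$, $f[a,b]$ denotes the coefficient of $x^ay^b$ in $f$. -}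

module Defs where

open import Data.Nat as ℕ using (ℕ; zero; suc; _∸_; _≡ᵇ_)
open import Data.Nat.Properties using (_!≢0; m*n≢0)
open import Data.Nat using (_!)
open import Data.Nat.DivMod using (_/_; _%_)
open import Data.Integer as ℤ using (ℤ; +_)
open import Data.Fin using (Fin; toℕ) renaming (zero to f0)
open import Data.Fin.Base using (fromℕ<)
open import Data.Vec as Vec using (Vec; []; _∷_; foldr; zipWith; countᵇ)
open import Data.List as List using (List; concatMap; allFin; filterᵇ; length)
open import Data.Bool using (Bool; _∧_; _∨_)

ℤ₄ : Set
ℤ₄ = Fin 4

typeCount : ∀ {n} → ℕ → Vec ℤ₄ n → ℕ
typeCount k v = countᵇ (λ a → toℕ a ≡ᵇ k) v

dot : ∀ {n} → Vec ℤ₄ n → Vec ℤ₄ n → ℕ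
dot b v = foldr _ ℕ._+_ 0 (zipWith (λ x y → toℕ x ℕ.* toℕ y) b v) % 4

allVecs : (n : ℕ) → List (Vec ℤ₄ n)
allVecs zero = [] List.∷ List.[]
allVecs (suc n) = concatMap (λ a → List.map (a ∷_) (allVecs n)) (allFin 4)

hasType : ∀ {n} → ℕ → ℕ → ℕ → ℕ → Vec ℤ₄ n → Bool
hasType t0 t1 t2 t3 b =
  (typeCount 0 b ≡ᵇ t0) ∧ (typeCount 1 b ≡ᵇ t1) ∧ (typeCount 2 b ≡ᵇ t2) ∧ (typeCount 3 b ≡ᵇ t3)

β : ∀ {n} → ℕ → ℕ → Vec ℤ₄ n → ℕ
β r s v = length (filterᵇ (λ b → hasType r s r s b ∧ ((dot b v ≡ᵇ 0) ∨ (dot b v ≡ᵇ 2))) (allVecs _))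

multinom : ℕ → ℕ → ℕ → ℕ
multinom n r s = (n ! / (r ! ℕ.* s ! ℕ.* r ! ℕ.* s !)) {{nz}}
  where
  nz = m*n≢0 (r ! ℕ.* s ! ℕ.* r !) (s !) {{m*n≢0 (r ! ℕ.* s !) (r !) {{m*n≢0 (r !) (s !) {{r !≢0}} {{s !≢0}}}} {{r !≢0}}}} {{s !≢0}}

-- Bivariate polynomials over ℤ, as coefficient functions:
-- P a b = coefficient of x^a y^b.

Poly : Set
Poly = ℕ → ℕ → ℤ

sumTo : ℕ → (ℕ → ℤ) → ℤ
sumTo zero f = f 0
sumTo (suc m) f = sumTo m f ℤ.+ f (suc m)

X : Poly
X 1 0 = + 1
X _ _ = + 0

Y : Poly
Y 0 1 = + 1
Y _ _ = + 0

one : Poly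
one 0 0 = + 1
one _ _ = + 0

_⊕_ : Poly → Poly → Poly
(f ⊕ g) a b = f a b ℤ.+ g a b

_⊖_ : Poly → Poly → Poly
(f ⊖ g) a b = f a b ℤ.- g a b

_⊗_ : Poly → Poly → Poly
(f ⊗ g) a b = sumTo a (λ i → sumTo b (λ j → f i j ℤ.* g (a ∸ i) (b ∸ j)))

_^^_ : Poly → ℕ → Poly
f ^^ zero = one
f ^^ suc k = f ⊗ (f ^^ k)

coeff : Poly → ℕ → ℕ → ℤ
coeff f a b = f a b

-- 2·P where P = ½(x+y)^n + ½(x+y)^{2r}(x−y)^{2s}, i.e. (x+y)^n + (x+y)^{2r}(x−y)^{2s}
twiceP : ℕ → ℕ → ℕ → Poly
twiceP n r s = ((X ⊕ Y) ^^ n) ⊕ (((X ⊕ Y) ^^ (2 ℕ.* r)) ⊗ ((X ⊖ Y) ^^ (2 ℕ.* s)))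

{-# OPTIONS --safe #-}
module Submission where

-- A vector b of type (r,s,r,s) has b · v ≡ Σ_{k : b_k odd} v_k (mod 2), so whether b · v ∈ {0,2} depends
-- only on the set J of odd positions of b, a (2s)-subset of the n positions, and every such J comes from
-- C(2r,r)·C(2s,s) vectors b. Writing a = t₀ + t₂ and m = t₁ + t₃, the (2s)-subsets J with Σ_{k∈J} v_k even
-- outnumber those with the sum odd by K, the coefficient of y^(2s) in (1 - y)^m (1 + y)^a, and there are
-- C(n,2s) of them in all; hence 2β = C(2r,r)·C(2s,s)·(C(n,2s) + K). Krawtchouk reciprocity
-- C(n,m)·K = C(n,2s)·[y^m] (1 - y)^(2s) (1 + y)^(2r) turns this into the coefficient of x^a y^m in
-- (x + y)^n + (x + y)^(2r) (x - y)^(2s), and C(n,2r)·C(2r,r)·C(2s,s) is the multinomial coefficient.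

open import Data.Bool.Base using (Bool; true; false; _∧_; _∨_; T)
open import Data.Bool.Properties using (∧-zeroʳ)
open import Data.Fin.Base using (toℕ)
open import Data.Fin.Patterns using (0F; 1F; 2F; 3F)
open import Data.Integer.Base as ℤ
  using (ℤ; +_; 0ℤ; -1ℤ; _^_)
  renaming (_+_ to _+ℤ_; _-_ to _-ℤ_; _*_ to _*ℤ_)
import Data.Integer.Properties as ℤ
open import Data.Integer.Tactic.RingSolver using (solve-∀)
open import Data.List.Base using (List; []; _∷_; _++_; map; concatMap; length; filterᵇ; allFin)
open import Data.List.Properties using (filter-++; filter-≐; length-++; map-cong)
open import Data.Nat.Base
  using (ℕ; zero; suc; _+_; _*_; _∸_; _≤_; _<_; z≤n; s≤s; _!; NonZero; _≡ᵇ_; parity)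
open import Data.Nat.Combinatorics
  using (_C_; nCk≡n!/k![n-k]!; k![n∸k]!∣n!; k>n⇒nCk≡0; nCk+nC[k+1]≡[n+1]C[k+1]; nCk≡nC[n∸k]; nCn≡1)
open import Data.Nat.DivMod using (_/_; _%_; m/n*n≡m; m*n/n≡m; [m+n]%n≡m%n)
open import Data.Nat.ListAction using (sum)
open import Data.Nat.Properties
open import Data.Nat.Tactic.RingSolver using () renaming (solve-∀ to ℕ-solve-∀)
open import Data.Parity.Base as ℙ using (Parity; 0ℙ; 1ℙ)
import Data.Parity.Properties as ℙ
open import Data.Product.Base using (_,_)
open import Data.Sum.Base using (_⊎_; inj₁; inj₂; [_,_]′)
open import Data.Vec.Base using (Vec; foldr; zipWith) renaming ([] to []ᵛ; _∷_ to _∷ᵛ_)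
open import Function.Base using (_∘_)
open import Relation.Binary.PropositionalEquality
open import Relation.Nullary.Decidable.Core using (does; T?)

open import Defs

sumTo-cong : ∀ n {f g : ℕ → ℤ} → (∀ k → k ≤ n → f k ≡ g k) → sumTo n f ≡ sumTo n g
sumTo-cong zero    f≗g = f≗g 0 z≤n
sumTo-cong (suc n) f≗g =
  cong₂ _+ℤ_ (sumTo-cong n (λ k k≤n → f≗g k (m≤n⇒m≤1+n k≤n))) (f≗g (suc n) ≤-refl)

sumTo-+ : ∀ n (f g : ℕ → ℤ) → sumTo n (λ k → f k +ℤ g k) ≡ sumTo n f +ℤ sumTo n g
sumTo-+ zero    f g = refl
sumTo-+ (suc n) f g =
  trans (cong (_+ℤ (f (suc n) +ℤ g (suc n))) (sumTo-+ n f g))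
    (interchange (sumTo n f) (sumTo n g) (f (suc n)) (g (suc n)))
  where
  interchange : ∀ a b c d → (a +ℤ b) +ℤ (c +ℤ d) ≡ (a +ℤ c) +ℤ (b +ℤ d)
  interchange = solve-∀

sumTo-− : ∀ n (f g : ℕ → ℤ) → sumTo n (λ k → f k -ℤ g k) ≡ sumTo n f -ℤ sumTo n g
sumTo-− zero    f g = refl
sumTo-− (suc n) f g =
  trans (cong (_+ℤ (f (suc n) -ℤ g (suc n))) (sumTo-− n f g))
    (interchange (sumTo n f) (sumTo n g) (f (suc n)) (g (suc n)))
  where
  interchange : ∀ a b c d → (a -ℤ b) +ℤ (c -ℤ d) ≡ (a +ℤ c) -ℤ (b +ℤ d)
  interchange = solve-∀

sumTo-*ˡ : ∀ n c (f : ℕ → ℤ) → sumTo n (λ k → c *ℤ f k) ≡ c *ℤ sumTo n f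
sumTo-*ˡ zero    c f = refl
sumTo-*ˡ (suc n) c f =
  trans (cong (_+ℤ c *ℤ f (suc n)) (sumTo-*ˡ n c f)) (sym (ℤ.*-distribˡ-+ c _ _))

sumTo-suc : ∀ n (f : ℕ → ℤ) → sumTo (suc n) f ≡ f 0 +ℤ sumTo n (f ∘ suc)
sumTo-suc zero    f = refl
sumTo-suc (suc n) f =
  trans (cong (_+ℤ f (suc (suc n))) (sumTo-suc n f)) (ℤ.+-assoc (f 0) _ _)

sumTo-zero : ∀ n (f : ℕ → ℤ) → (∀ k → f k ≡ 0ℤ) → sumTo n f ≡ 0ℤ
sumTo-zero zero    f f≡0 = f≡0 0
sumTo-zero (suc n) f f≡0 = cong₂ _+ℤ_ (sumTo-zero n f f≡0) (f≡0 (suc n))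

sumTo-extend : ∀ {m n} (f : ℕ → ℤ) → m ≤ n → (∀ k → m < k → f k ≡ 0ℤ) → sumTo n f ≡ sumTo m f
sumTo-extend {n = zero}  f z≤n   f≡0 = refl
sumTo-extend {n = suc n} f m≤1+n f≡0 with m≤n⇒m<n∨m≡n m≤1+n
... | inj₂ refl      = refl
... | inj₁ (s≤s m≤n) =
  trans (cong₂ _+ℤ_ (sumTo-extend f m≤n f≡0) (f≡0 (suc n) (s≤s m≤n))) (ℤ.+-identityʳ _)

sumTo-head : ∀ n (f : ℕ → ℤ) → (∀ k → f (suc k) ≡ 0ℤ) → sumTo n f ≡ f 0
sumTo-head n f f≡0 = sumTo-extend {n = n} f z≤n λ { (suc k) _ → f≡0 k }

pascalℤ : ∀ n k → + (suc n C suc k) ≡ + (n C k) +ℤ + (n C suc k)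
pascalℤ n k = trans (cong +_ (sym (nCk+nC[k+1]≡[n+1]C[k+1] n k))) (ℤ.pos-+ (n C k) (n C suc k))

C-sym : ∀ {x y n} → x + y ≡ n → n C x ≡ n C y
C-sym {x} {y} refl = trans (nCk≡nC[n∸k] (m≤m+n x y)) (cong ((x + y) C_) (m+n∸m≡n x y))

binomial-factorials : ∀ x y → ((x + y) C x) * (x ! * y !) ≡ (x + y) !
binomial-factorials x y =
  subst (λ z → ((x + y) C x) * (x ! * z !) ≡ (x + y) !) (m+n∸m≡n x y) (C*factorials (m≤m+n x y))
  where
  C*factorials : ∀ {n k} → k ≤ n → (n C k) * (k ! * (n ∸ k) !) ≡ n !
  C*factorials {n} {k} k≤n =
    trans (cong (_* (k ! * (n ∸ k) !)) (nCk≡n!/k![n-k]! k≤n)) (m/n*n≡m (k![n∸k]!∣n! k≤n))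
    where instance _ = k !* (n ∸ k) !≢0

multinomial : ∀ k q u w {N} → N ≡ (k + q) + (u + w) →
  (N C (k + q)) * (((k + q) C k) * ((u + w) C u)) * (k ! * q ! * (u ! * w !)) ≡ N !
multinomial k q u w refl = begin
  (N C (k + q)) * (((k + q) C k) * ((u + w) C u)) * (k ! * q ! * (u ! * w !))
    ≡⟨ regroup (N C (k + q)) ((k + q) C k) ((u + w) C u) (k !) (q !) (u !) (w !) ⟩
  (N C (k + q)) * (((k + q) C k) * (k ! * q !) * (((u + w) C u) * (u ! * w !)))
    ≡⟨ cong ((N C (k + q)) *_) (cong₂ _*_ (binomial-factorials k q) (binomial-factorials u w)) ⟩
  (N C (k + q)) * ((k + q) ! * (u + w) !)
    ≡⟨ binomial-factorials (k + q) (u + w) ⟩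
  N ! ∎
  where
  open ≡-Reasoning
  N = (k + q) + (u + w)
  regroup : ∀ A B C K Q U W → A * (B * C) * (K * Q * (U * W)) ≡ A * (B * (K * Q) * (C * (U * W)))
  regroup = ℕ-solve-∀

-- N!/(k! q! u! w!) read in two ways.
multinomial-swap : ∀ k q u w {m a j l N} → m ≡ k + q → a ≡ u + w → j ≡ k + u → l ≡ q + w → N ≡ m + a →
  (N C m) * ((m C k) * (a C u)) ≡ (N C j) * ((j C k) * (l C q))
multinomial-swap k q u w refl refl refl refl refl =
  *-cancelʳ-≡ _ _ (k ! * q ! * (u ! * w !)) {{nonZero}}
    (trans (multinomial k q u w refl)
      (sym (trans (cong (rhs *_) (reorder (k !) (q !) (u !) (w !)))
                  (multinomial k u q w (interchange k q u w)))))
  where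
  rhs = (((k + q) + (u + w)) C (k + u)) * (((k + u) C k) * ((q + w) C q))
  nonZero : NonZero (k ! * q ! * (u ! * w !))
  nonZero = m*n≢0 _ _ {{k !* q !≢0}} {{u !* w !≢0}}
  reorder : ∀ K Q U W → K * Q * (U * W) ≡ K * U * (Q * W)
  reorder = ℕ-solve-∀
  interchange : ∀ k q u w → (k + q) + (u + w) ≡ (k + u) + (q + w)
  interchange = ℕ-solve-∀

-- Krawtchouk numbers

yShift : (ℕ → ℤ) → ℕ → ℤ
yShift c zero    = 0ℤ
yShift c (suc b) = c b

-- The coefficient of yʲ in (1 - y)ᵐ (1 + y)ᵃ, i.e. the Krawtchouk polynomial Kⱼ(m) of length m + a.
krawtchouk : ℕ → ℕ → ℕ → ℤ
krawtchouk m a j = sumTo j λ k → -1ℤ ^ k *ℤ (+ (m C k) *ℤ + (a C (j ∸ k)))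

krawtchouk-vanish : ∀ m a j → m + a < j → krawtchouk m a j ≡ 0ℤ
krawtchouk-vanish m a j m+a<j = sumTo-zero j _ term≡0
  where
  a<j∸k : ∀ {k} → k ≤ m → a < j ∸ k
  a<j∸k {k} k≤m = subst (_< j ∸ k) (m+n∸m≡n k a)
    (∸-monoˡ-< (≤-<-trans (+-monoˡ-≤ a k≤m) m+a<j) (m≤m+n k a))
  term≡0 : ∀ k → -1ℤ ^ k *ℤ (+ (m C k) *ℤ + (a C (j ∸ k))) ≡ 0ℤ
  term≡0 k with ≤-<-connex k m
  ... | inj₂ m<k rewrite k>n⇒nCk≡0 m<k = ℤ.*-zeroʳ (-1ℤ ^ k)
  ... | inj₁ k≤m rewrite k>n⇒nCk≡0 (a<j∸k k≤m) | ℤ.*-zeroʳ (+ (m C k)) = ℤ.*-zeroʳ (-1ℤ ^ k)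

krawtchouk-suc-plus : ∀ m a j → krawtchouk m (suc a) j ≡ krawtchouk m a j +ℤ yShift (krawtchouk m a) j
krawtchouk-suc-plus m a zero    = refl
krawtchouk-suc-plus m a (suc j) = begin
  sumTo j (λ k → term k (+ (suc a C (suc j ∸ k)))) +ℤ term (suc j) (+ (suc a C (j ∸ j)))
    ≡⟨ cong₂ _+ℤ_ (trans (sumTo-cong j split) (sumTo-+ j _ _))
                  (cong (term (suc j) ∘ +_ ∘ (suc a C_)) (n∸n≡0 j)) ⟩
  (krawtchouk m a j +ℤ S) +ℤ term (suc j) (+ 1)
    ≡⟨ rearrange (krawtchouk m a j) S (term (suc j) (+ 1)) ⟩
  (S +ℤ term (suc j) (+ 1)) +ℤ krawtchouk m a j
    ≡⟨ cong (λ i → S +ℤ term (suc j) (+ (a C i)) +ℤ krawtchouk m a j) (sym (n∸n≡0 j)) ⟩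
  krawtchouk m a (suc j) +ℤ krawtchouk m a j ∎
  where
  open ≡-Reasoning
  term : ℕ → ℤ → ℤ
  term k c = -1ℤ ^ k *ℤ (+ (m C k) *ℤ c)
  S = sumTo j (λ k → term k (+ (a C (suc j ∸ k))))
  split : ∀ k → k ≤ j →
    term k (+ (suc a C (suc j ∸ k))) ≡ term k (+ (a C (j ∸ k))) +ℤ term k (+ (a C (suc j ∸ k)))
  split k k≤j = begin
    term k (+ (suc a C (suc j ∸ k)))
      ≡⟨ cong (term k ∘ +_ ∘ (suc a C_)) (+-∸-assoc 1 k≤j) ⟩
    term k (+ (suc a C suc (j ∸ k)))
      ≡⟨ cong (term k) (pascalℤ a (j ∸ k)) ⟩
    term k (+ (a C (j ∸ k)) +ℤ + (a C suc (j ∸ k)))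
      ≡⟨ cong (-1ℤ ^ k *ℤ_) (ℤ.*-distribˡ-+ (+ (m C k)) _ _) ⟩
    -1ℤ ^ k *ℤ (+ (m C k) *ℤ + (a C (j ∸ k)) +ℤ + (m C k) *ℤ + (a C suc (j ∸ k)))
      ≡⟨ ℤ.*-distribˡ-+ (-1ℤ ^ k) _ _ ⟩
    term k (+ (a C (j ∸ k))) +ℤ term k (+ (a C suc (j ∸ k)))
      ≡⟨ cong (λ i → term k (+ (a C (j ∸ k))) +ℤ term k (+ (a C i))) (+-∸-assoc 1 k≤j) ⟨
    term k (+ (a C (j ∸ k))) +ℤ term k (+ (a C (suc j ∸ k))) ∎
  rearrange : ∀ x y z → (x +ℤ y) +ℤ z ≡ (y +ℤ z) +ℤ x
  rearrange = solve-∀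

krawtchouk-suc-minus : ∀ m a j → krawtchouk (suc m) a j ≡ krawtchouk m a j -ℤ yShift (krawtchouk m a) j
krawtchouk-suc-minus m a zero    = refl
krawtchouk-suc-minus m a (suc j) = begin
  krawtchouk (suc m) a (suc j)
    ≡⟨ sumTo-suc j _ ⟩
  first +ℤ sumTo j (λ k → -1ℤ ^ suc k *ℤ (+ (suc m C suc k) *ℤ + (a C (j ∸ k))))
    ≡⟨ cong (first +ℤ_) (trans (sumTo-cong j (λ k _ → split k)) (sumTo-− j _ _)) ⟩
  first +ℤ (sumTo j (λ k → -1ℤ ^ suc k *ℤ (+ (m C suc k) *ℤ + (a C (j ∸ k)))) -ℤ krawtchouk m a j)
    ≡⟨ sym (ℤ.+-assoc first _ _) ⟩
  (first +ℤ sumTo j (λ k → -1ℤ ^ suc k *ℤ (+ (m C suc k) *ℤ + (a C (j ∸ k))))) -ℤ krawtchouk m a j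
    ≡⟨ cong (_-ℤ krawtchouk m a j) (sym (sumTo-suc j _)) ⟩
  krawtchouk m a (suc j) -ℤ krawtchouk m a j ∎
  where
  open ≡-Reasoning
  first = -1ℤ ^ 0 *ℤ (+ 1 *ℤ + (a C suc j))
  split : ∀ k → -1ℤ ^ suc k *ℤ (+ (suc m C suc k) *ℤ + (a C (j ∸ k)))
              ≡ -1ℤ ^ suc k *ℤ (+ (m C suc k) *ℤ + (a C (j ∸ k))) -ℤ -1ℤ ^ k *ℤ (+ (m C k) *ℤ + (a C (j ∸ k)))
  split k = trans (cong (λ x → -1ℤ ^ suc k *ℤ (x *ℤ + (a C (j ∸ k)))) (pascalℤ m k))
                  (distrib (-1ℤ ^ k) (+ (m C k)) (+ (m C suc k)) (+ (a C (j ∸ k))))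
    where
    distrib : ∀ s x y c → -1ℤ *ℤ s *ℤ ((x +ℤ y) *ℤ c) ≡ -1ℤ *ℤ s *ℤ (y *ℤ c) -ℤ s *ℤ (x *ℤ c)
    distrib = solve-∀

reciprocity-term : ∀ {m a j l N k} → m + a ≡ N → j + l ≡ N → k ≤ m → k ≤ j →
  (N C m) * ((m C k) * (a C (j ∸ k))) ≡ (N C j) * ((j C k) * (l C (m ∸ k)))
reciprocity-term {m} {a} {j} {l} {N} {k} m+a≡N j+l≡N k≤m k≤j = by-cases (≤-<-connex u a)
  where
  q = m ∸ k
  u = j ∸ k
  m≡k+q : m ≡ k + q
  m≡k+q = sym (m+[n∸m]≡n k≤m)
  j≡k+u : j ≡ k + u
  j≡k+u = sym (m+[n∸m]≡n k≤j)
  q+a≡u+l : q + a ≡ u + l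
  q+a≡u+l = +-cancelˡ-≡ k _ _ (begin
    k + (q + a)   ≡⟨ +-assoc k q a ⟨
    k + q + a     ≡⟨ cong (_+ a) m≡k+q ⟨
    m + a         ≡⟨ trans m+a≡N (sym j+l≡N) ⟩
    j + l         ≡⟨ cong (_+ l) j≡k+u ⟩
    k + u + l     ≡⟨ +-assoc k u l ⟩
    k + (u + l)   ∎)
    where open ≡-Reasoning
  vanishing : ∀ {x y} A B → x < y → A * (B * (x C y)) ≡ 0
  vanishing {x} {y} A B x<y rewrite k>n⇒nCk≡0 x<y | *-zeroʳ B = *-zeroʳ A
  by-cases : u ≤ a ⊎ a < u → (N C m) * ((m C k) * (a C u)) ≡ (N C j) * ((j C k) * (l C q))
  by-cases (inj₁ u≤a) =
    multinomial-swap k q u (a ∸ u) m≡k+q a≡u+w j≡k+u l≡q+w (sym m+a≡N)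
    where
    a≡u+w = sym (m+[n∸m]≡n u≤a)
    l≡q+w : l ≡ q + (a ∸ u)
    l≡q+w = sym (+-cancelˡ-≡ u _ _ (begin
      u + (q + (a ∸ u))   ≡⟨ x+[y+z]≡y+[x+z] u q (a ∸ u) ⟩
      q + (u + (a ∸ u))   ≡⟨ cong (_+_ q) a≡u+w ⟨
      q + a               ≡⟨ q+a≡u+l ⟩
      u + l               ∎))
      where
      open ≡-Reasoning
      x+[y+z]≡y+[x+z] : ∀ x y z → x + (y + z) ≡ y + (x + z)
      x+[y+z]≡y+[x+z] = ℕ-solve-∀
  by-cases (inj₂ a<u) = trans (vanishing (N C m) (m C k) a<u) (sym (vanishing (N C j) (j C k) l<q))
    where
    l<q : l < q
    l<q = +-cancelˡ-< u l q (begin-strict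
      u + l   ≡⟨ q+a≡u+l ⟨
      q + a   <⟨ +-monoʳ-< q a<u ⟩
      q + u   ≡⟨ +-comm q u ⟩
      u + q   ∎)
      where open ≤-Reasoning

krawtchouk-reciprocity : ∀ {m a j l N} → m + a ≡ N → j + l ≡ N →
  + (N C m) *ℤ krawtchouk m a j ≡ + (N C j) *ℤ krawtchouk j l m
krawtchouk-reciprocity {m} {a} {j} {l} {N} m+a≡N j+l≡N =
  [ reciprocity-≤ {m} {a} {j} {l} m+a≡N j+l≡N
  , (λ m<j → sym (reciprocity-≤ {j} {l} {m} {a} j+l≡N m+a≡N (<⇒≤ m<j)))
  ]′ (≤-<-connex j m)
  where
  term : ℕ → ℕ → ℕ → ℕ → ℤ
  term m a j k = -1ℤ ^ k *ℤ (+ (m C k) *ℤ + (a C (j ∸ k)))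
  scale-term : ∀ c k x y → + c *ℤ (-1ℤ ^ k *ℤ (+ x *ℤ + y)) ≡ -1ℤ ^ k *ℤ + (c * (x * y))
  scale-term c k x y = trans (swap (+ c) (-1ℤ ^ k) (+ x) (+ y))
    (cong (-1ℤ ^ k *ℤ_) (sym (trans (ℤ.pos-* c (x * y)) (cong (+ c *ℤ_) (ℤ.pos-* x y)))))
    where
    swap : ∀ c s x y → c *ℤ (s *ℤ (x *ℤ y)) ≡ s *ℤ (c *ℤ (x *ℤ y))
    swap = solve-∀
  reciprocity-≤ : ∀ {m a j l N} → m + a ≡ N → j + l ≡ N → j ≤ m →
    + (N C m) *ℤ krawtchouk m a j ≡ + (N C j) *ℤ krawtchouk j l m
  reciprocity-≤ {m} {a} {j} {l} {N} m+a≡N j+l≡N j≤m = begin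
    + (N C m) *ℤ krawtchouk m a j            ≡⟨ sumTo-*ˡ j (+ (N C m)) (term m a j) ⟨
    sumTo j (λ k → + (N C m) *ℤ term m a j k) ≡⟨ sumTo-cong j termwise ⟩
    sumTo j (λ k → + (N C j) *ℤ term j l m k) ≡⟨ sumTo-*ˡ j (+ (N C j)) (term j l m) ⟩
    + (N C j) *ℤ sumTo j (term j l m)         ≡⟨ cong (+ (N C j) *ℤ_) (sumTo-extend (term j l m) j≤m beyond-j) ⟨
    + (N C j) *ℤ krawtchouk j l m            ∎
    where
    open ≡-Reasoning
    termwise : ∀ k → k ≤ j → + (N C m) *ℤ term m a j k ≡ + (N C j) *ℤ term j l m k
    termwise k k≤j = trans (scale-term (N C m) k (m C k) (a C (j ∸ k)))
      (trans (cong (λ z → -1ℤ ^ k *ℤ + z) (reciprocity-term m+a≡N j+l≡N (≤-trans k≤j j≤m) k≤j))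
             (sym (scale-term (N C j) k (j C k) (l C (m ∸ k)))))
    beyond-j : ∀ k → j < k → term j l m k ≡ 0ℤ
    beyond-j k j<k rewrite k>n⇒nCk≡0 j<k = ℤ.*-zeroʳ (-1ℤ ^ k)

-- Coefficients of products of (x + y) and (x - y)

X⊗-zero : ∀ f b → (X ⊗ f) 0 b ≡ 0ℤ
X⊗-zero f b = sumTo-zero b _ λ _ → refl

X⊗-suc : ∀ f a b → (X ⊗ f) (suc a) b ≡ f a b
X⊗-suc f a b = begin
  (X ⊗ f) (suc a) b
    ≡⟨ sumTo-suc a _ ⟩
  (X ⊗ f) 0 b +ℤ sumTo a (λ i → sumTo b (λ j → X (suc i) j *ℤ f (a ∸ i) (b ∸ j)))
    ≡⟨ cong₂ _+ℤ_ (X⊗-zero f b) (sumTo-head a _ λ _ → sumTo-zero b _ λ _ → refl) ⟩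
  0ℤ +ℤ sumTo b (λ j → X 1 j *ℤ f a (b ∸ j))
    ≡⟨ ℤ.+-identityˡ _ ⟩
  sumTo b (λ j → X 1 j *ℤ f a (b ∸ j))
    ≡⟨ sumTo-head b _ (λ _ → refl) ⟩
  + 1 *ℤ f a b
    ≡⟨ ℤ.*-identityˡ (f a b) ⟩
  f a b ∎
  where open ≡-Reasoning

Y⊗-zero : ∀ f a → (Y ⊗ f) a 0 ≡ 0ℤ
Y⊗-zero f a = sumTo-head a _ λ _ → refl

Y⊗-suc : ∀ f a b → (Y ⊗ f) a (suc b) ≡ f a b
Y⊗-suc f a b = begin
  (Y ⊗ f) a (suc b)
    ≡⟨ sumTo-head a _ (λ _ → sumTo-zero (suc b) _ λ _ → refl) ⟩
  sumTo (suc b) (λ j → Y 0 j *ℤ f a (suc b ∸ j))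
    ≡⟨ sumTo-suc b _ ⟩
  0ℤ +ℤ sumTo b (λ j → Y 0 (suc j) *ℤ f a (b ∸ j))
    ≡⟨ ℤ.+-identityˡ _ ⟩
  sumTo b (λ j → Y 0 (suc j) *ℤ f a (b ∸ j))
    ≡⟨ sumTo-head b _ (λ _ → refl) ⟩
  + 1 *ℤ f a b
    ≡⟨ ℤ.*-identityˡ (f a b) ⟩
  f a b ∎
  where open ≡-Reasoning

one-⊗ : ∀ f a b → (one ⊗ f) a b ≡ f a b
one-⊗ f a b = trans (sumTo-head a _ λ _ → sumTo-zero b _ λ _ → refl)
                    (trans (sumTo-head b _ λ _ → refl) (ℤ.*-identityˡ (f a b)))

⊗-congˡ : ∀ {f f′} g a b → (∀ i j → f i j ≡ f′ i j) → (f ⊗ g) a b ≡ (f′ ⊗ g) a b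
⊗-congˡ g a b f≗f′ = sumTo-cong a λ i _ → sumTo-cong b λ j _ → cong (_*ℤ g (a ∸ i) (b ∸ j)) (f≗f′ i j)

⊕-⊗-distribʳ : ∀ f g h a b → ((f ⊕ g) ⊗ h) a b ≡ (f ⊗ h) a b +ℤ (g ⊗ h) a b
⊕-⊗-distribʳ f g h a b =
  trans (sumTo-cong a λ i _ →
           trans (sumTo-cong b λ j _ → ℤ.*-distribʳ-+ (h (a ∸ i) (b ∸ j)) (f i j) (g i j)) (sumTo-+ b _ _))
        (sumTo-+ a _ _)

⊖-⊗-distribʳ : ∀ f g h a b → ((f ⊖ g) ⊗ h) a b ≡ (f ⊗ h) a b -ℤ (g ⊗ h) a b
⊖-⊗-distribʳ f g h a b =
  trans (sumTo-cong a λ i _ →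
           trans (sumTo-cong b λ j _ → distrib (f i j) (g i j) (h (a ∸ i) (b ∸ j))) (sumTo-− b _ _))
        (sumTo-− a _ _)
  where
  distrib : ∀ x y z → (x -ℤ y) *ℤ z ≡ x *ℤ z -ℤ y *ℤ z
  distrib = solve-∀

X⊗-assoc : ∀ f g a b → ((X ⊗ f) ⊗ g) a b ≡ (X ⊗ (f ⊗ g)) a b
X⊗-assoc f g zero    b =
  trans (sumTo-zero b _ λ j → cong (_*ℤ g 0 (b ∸ j)) (X⊗-zero f j)) (sym (X⊗-zero (f ⊗ g) b))
X⊗-assoc f g (suc a) b = begin
  ((X ⊗ f) ⊗ g) (suc a) b
    ≡⟨ sumTo-suc a _ ⟩
  sumTo b (λ j → (X ⊗ f) 0 j *ℤ g (suc a) (b ∸ j))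
    +ℤ sumTo a (λ i → sumTo b λ j → (X ⊗ f) (suc i) j *ℤ g (a ∸ i) (b ∸ j))
    ≡⟨ cong₂ _+ℤ_ (sumTo-zero b _ λ j → cong (_*ℤ g (suc a) (b ∸ j)) (X⊗-zero f j))
                  (sumTo-cong a λ i _ → sumTo-cong b λ j _ → cong (_*ℤ g (a ∸ i) (b ∸ j)) (X⊗-suc f i j)) ⟩
  0ℤ +ℤ (f ⊗ g) a b
    ≡⟨ ℤ.+-identityˡ _ ⟩
  (f ⊗ g) a b
    ≡⟨ sym (X⊗-suc (f ⊗ g) a b) ⟩
  (X ⊗ (f ⊗ g)) (suc a) b ∎
  where open ≡-Reasoning

Y⊗-assoc : ∀ f g a b → ((Y ⊗ f) ⊗ g) a b ≡ (Y ⊗ (f ⊗ g)) a b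
Y⊗-assoc f g a zero    =
  trans (sumTo-zero a _ λ i → cong (_*ℤ g (a ∸ i) 0) (Y⊗-zero f i)) (sym (Y⊗-zero (f ⊗ g) a))
Y⊗-assoc f g a (suc b) = trans (sumTo-cong a λ i _ → row i) (sym (Y⊗-suc (f ⊗ g) a b))
  where
  row : ∀ i → sumTo (suc b) (λ j → (Y ⊗ f) i j *ℤ g (a ∸ i) (suc b ∸ j))
            ≡ sumTo b (λ j → f i j *ℤ g (a ∸ i) (b ∸ j))
  row i = trans (sumTo-suc b _)
    (trans (cong₂ _+ℤ_ (cong (_*ℤ g (a ∸ i) (suc b)) (Y⊗-zero f i))
                       (sumTo-cong b λ j _ → cong (_*ℤ g (a ∸ i) (b ∸ j)) (Y⊗-suc f i j)))
           (ℤ.+-identityˡ _))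

[X⊕Y]⊗-assoc : ∀ f g a b → (((X ⊕ Y) ⊗ f) ⊗ g) a b ≡ ((X ⊕ Y) ⊗ (f ⊗ g)) a b
[X⊕Y]⊗-assoc f g a b = begin
  (((X ⊕ Y) ⊗ f) ⊗ g) a b                        ≡⟨ ⊗-congˡ g a b (⊕-⊗-distribʳ X Y f) ⟩
  (((X ⊗ f) ⊕ (Y ⊗ f)) ⊗ g) a b                  ≡⟨ ⊕-⊗-distribʳ (X ⊗ f) (Y ⊗ f) g a b ⟩
  ((X ⊗ f) ⊗ g) a b +ℤ ((Y ⊗ f) ⊗ g) a b         ≡⟨ cong₂ _+ℤ_ (X⊗-assoc f g a b) (Y⊗-assoc f g a b) ⟩
  (X ⊗ (f ⊗ g)) a b +ℤ (Y ⊗ (f ⊗ g)) a b         ≡⟨ ⊕-⊗-distribʳ X Y (f ⊗ g) a b ⟨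
  ((X ⊕ Y) ⊗ (f ⊗ g)) a b                        ∎
  where open ≡-Reasoning

-- The homogeneous part of degree d of f is Σ_b c b · x^(d-b) y^b.
DegreeCoeffs : Poly → ℕ → (ℕ → ℤ) → Set
DegreeCoeffs f d c = ∀ a b → a + b ≡ d → f a b ≡ c b

X⊗-degree : ∀ {f d c} → DegreeCoeffs f d c → c (suc d) ≡ 0ℤ → DegreeCoeffs (X ⊗ f) (suc d) c
X⊗-degree {f} hf c[1+d]≡0 zero    b     refl = trans (X⊗-zero f b) (sym c[1+d]≡0)
X⊗-degree {f} hf c[1+d]≡0 (suc a) b a+b≡d = trans (X⊗-suc f a b) (hf a b (suc-injective a+b≡d))

Y⊗-degree : ∀ {f d c} → DegreeCoeffs f d c → DegreeCoeffs (Y ⊗ f) (suc d) (yShift c)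
Y⊗-degree {f} hf a zero    _     = Y⊗-zero f a
Y⊗-degree {f} hf a (suc b) a+b≡d = trans (Y⊗-suc f a b) (hf a b (suc-injective (trans (sym (+-suc a b)) a+b≡d)))

[X⊕Y]⊗-degree : ∀ {f d c} → DegreeCoeffs f d c → c (suc d) ≡ 0ℤ →
  DegreeCoeffs ((X ⊕ Y) ⊗ f) (suc d) (λ b → c b +ℤ yShift c b)
[X⊕Y]⊗-degree {f} hf c[1+d]≡0 a b a+b≡d =
  trans (⊕-⊗-distribʳ X Y f a b) (cong₂ _+ℤ_ (X⊗-degree hf c[1+d]≡0 a b a+b≡d) (Y⊗-degree hf a b a+b≡d))

[X⊖Y]⊗-degree : ∀ {f d c} → DegreeCoeffs f d c → c (suc d) ≡ 0ℤ →
  DegreeCoeffs ((X ⊖ Y) ⊗ f) (suc d) (λ b → c b -ℤ yShift c b)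
[X⊖Y]⊗-degree {f} hf c[1+d]≡0 a b a+b≡d =
  trans (⊖-⊗-distribʳ X Y f a b) (cong₂ _-ℤ_ (X⊗-degree hf c[1+d]≡0 a b a+b≡d) (Y⊗-degree hf a b a+b≡d))

[X⊕Y]^-coeffs : ∀ k → DegreeCoeffs ((X ⊕ Y) ^^ k) k (λ b → + (k C b))
[X⊕Y]^-coeffs zero    zero    zero    refl = refl
[X⊕Y]^-coeffs (suc k) a       b       a+b≡k =
  trans ([X⊕Y]⊗-degree ([X⊕Y]^-coeffs k) (cong +_ (k>n⇒nCk≡0 (n<1+n k))) a b a+b≡k) (pascal′ b)
  where
  pascal′ : ∀ b → + (k C b) +ℤ yShift (λ b → + (k C b)) b ≡ + (suc k C b)
  pascal′ zero    = refl
  pascal′ (suc b) = trans (ℤ.+-comm (+ (k C suc b)) (+ (k C b))) (sym (pascalℤ k b))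

[X⊖Y]^-coeffs : ∀ j → DegreeCoeffs ((X ⊖ Y) ^^ j) j (krawtchouk j 0)
[X⊖Y]^-coeffs zero    zero zero refl = refl
[X⊖Y]^-coeffs (suc j) a    b    a+b≡j =
  trans ([X⊖Y]⊗-degree ([X⊖Y]^-coeffs j) (krawtchouk-vanish j 0 (suc j) (s≤s (≤-reflexive (+-identityʳ j))))
                       a b a+b≡j)
        (sym (krawtchouk-suc-minus j 0 b))

[X⊕Y]^⊗[X⊖Y]^-coeffs : ∀ l j → DegreeCoeffs (((X ⊕ Y) ^^ l) ⊗ ((X ⊖ Y) ^^ j)) (l + j) (krawtchouk j l)
[X⊕Y]^⊗[X⊖Y]^-coeffs zero    j a b a+b≡j = trans (one-⊗ ((X ⊖ Y) ^^ j) a b) ([X⊖Y]^-coeffs j a b a+b≡j)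
[X⊕Y]^⊗[X⊖Y]^-coeffs (suc l) j a b a+b≡l+j =
  trans ([X⊕Y]⊗-assoc ((X ⊕ Y) ^^ l) ((X ⊖ Y) ^^ j) a b)
    (trans ([X⊕Y]⊗-degree ([X⊕Y]^⊗[X⊖Y]^-coeffs l j)
                          (krawtchouk-vanish j l (suc (l + j)) (s≤s (≤-reflexive (+-comm j l)))) a b a+b≡l+j)
           (sym (krawtchouk-suc-plus j l b)))

double : ∀ r → r + r ≡ 2 * r
double r = cong (_+_ r) (sym (+-identityʳ r))

twiceP-coeffs : ∀ r s → DegreeCoeffs (twiceP (2 * (r + s)) r s) (2 * (r + s))
                                     (λ b → + ((2 * (r + s)) C b) +ℤ krawtchouk (s + s) (r + r) b)
twiceP-coeffs r s a b a+b≡N =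
  cong₂ _+ℤ_ ([X⊕Y]^-coeffs (2 * (r + s)) a b a+b≡N)
    (trans ([X⊕Y]^⊗[X⊖Y]^-coeffs (2 * r) (2 * s) a b (trans a+b≡N (*-distribˡ-+ 2 r s)))
           (sym (cong₂ (λ S R → krawtchouk S R b) (double s) (double r))))

length-filterᵇ-++ : ∀ {A : Set} (P : A → Bool) xs ys →
  length (filterᵇ P (xs ++ ys)) ≡ length (filterᵇ P xs) + length (filterᵇ P ys)
length-filterᵇ-++ P xs ys = trans (cong length (filter-++ (T? ∘ P) xs ys)) (length-++ (filterᵇ P xs))

length-filterᵇ-map : ∀ {A B : Set} (P : B → Bool) (f : A → B) xs →
  length (filterᵇ P (map f xs)) ≡ length (filterᵇ (P ∘ f) xs)
length-filterᵇ-map P f []       = refl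
length-filterᵇ-map P f (x ∷ xs) with P (f x)
... | true  = cong suc (length-filterᵇ-map P f xs)
... | false = length-filterᵇ-map P f xs

length-filterᵇ-concatMap : ∀ {A B : Set} (P : B → Bool) (f : A → List B) xs →
  length (filterᵇ P (concatMap f xs)) ≡ sum (map (λ x → length (filterᵇ P (f x))) xs)
length-filterᵇ-concatMap P f []       = refl
length-filterᵇ-concatMap P f (x ∷ xs) =
  trans (length-filterᵇ-++ P (f x) _) (cong (_+_ (length (filterᵇ P (f x)))) (length-filterᵇ-concatMap P f xs))

count : ∀ {n} → (Vec ℤ₄ n → Bool) → ℕ
count P = length (filterᵇ P (allVecs _))

count-cong : ∀ {n} {P Q : Vec ℤ₄ n → Bool} → (∀ b → P b ≡ Q b) → count P ≡ count Q
count-cong {P = P} {Q} P≗Q =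
  cong length (filter-≐ (T? ∘ P) (T? ∘ Q) ((λ {b} → subst T (P≗Q b)) , (λ {b} → subst T (sym (P≗Q b))))
                       (allVecs _))

count-∧-false : ∀ {n} (P Q : Vec ℤ₄ n → Bool) → (∀ b → P b ≡ false) → count (λ b → P b ∧ Q b) ≡ 0
count-∧-false {n} P Q P≡false = trans (count-cong (λ b → cong (_∧ Q b) (P≡false b))) (none (allVecs n))
  where
  none : ∀ {A : Set} (xs : List A) → length (filterᵇ (λ _ → false) xs) ≡ 0
  none []       = refl
  none (_ ∷ xs) = none xs

count-∷ : ∀ {n} (P : Vec ℤ₄ (suc n) → Bool) →
  count P ≡ count (P ∘ (0F ∷ᵛ_)) + (count (P ∘ (1F ∷ᵛ_)) + (count (P ∘ (2F ∷ᵛ_)) + (count (P ∘ (3F ∷ᵛ_)) + 0)))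
count-∷ {n} P = trans (length-filterᵇ-concatMap P (λ h → map (h ∷ᵛ_) (allVecs n)) (allFin 4))
  (cong sum (map-cong (λ h → length-filterᵇ-map P (h ∷ᵛ_) (allVecs n)) (allFin 4)))

_⊙_ : ∀ {n} → Vec ℤ₄ n → Vec ℤ₄ n → ℕ
b ⊙ v = foldr _ _+_ 0 (zipWith (λ x y → toℕ x * toℕ y) b v)

isEven : ℕ → Bool
isEven m = does (parity m ℙ.≟ 0ℙ)

isEven-%4 : ∀ m → ((m % 4 ≡ᵇ 0) ∨ (m % 4 ≡ᵇ 2)) ≡ isEven m
isEven-%4 0 = refl
isEven-%4 1 = refl
isEven-%4 2 = refl
isEven-%4 3 = refl
isEven-%4 (suc (suc (suc (suc m)))) =
  trans (cong (λ r → (r ≡ᵇ 0) ∨ (r ≡ᵇ 2)) (trans (cong (_% 4) (+-comm 4 m)) ([m+n]%n≡m%n m 4)))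
        (isEven-%4 m)

parity-offset : ∀ e h x → parity (e + h * x) ≡ parity h ℙ.* parity x ℙ.+ parity e
parity-offset e h x =
  trans (ℙ.+-homo-+ e (h * x)) (trans (ℙ.+-comm (parity e) _) (cong (ℙ._+ parity e) (ℙ.*-homo-* h x)))

-- Parity patterns

onPred : ℕ → (ℕ → ℕ) → ℕ
onPred zero    f = 0
onPred (suc c) f = f c

onPred-cong : ∀ c {f g : ℕ → ℕ} → (∀ k → f k ≡ g k) → onPred c f ≡ onPred c g
onPred-cong zero    f≗g = refl
onPred-cong (suc c) f≗g = f≗g c

onPred-*ˡ : ∀ c B (f : ℕ → ℕ) → onPred c (λ k → B * f k) ≡ B * onPred c f
onPred-*ˡ zero    B f = sym (*-zeroʳ B)
onPred-*ˡ (suc c) B f = refl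

onPred-pascal : ∀ a b (f : ℕ → ℕ) →
  onPred a (λ a′ → ((a′ + b) C a′) * f (a′ + b)) + onPred b (λ b′ → ((a + b′) C a) * f (a + b′))
    ≡ ((a + b) C a) * onPred (a + b) f
onPred-pascal zero    zero    f = refl
onPred-pascal zero    (suc b) f = refl
onPred-pascal (suc a) zero    f rewrite +-identityʳ a =
  trans (+-identityʳ _) (cong (_* f a) (trans (nCn≡1 a) (sym (nCn≡1 (suc a)))))
onPred-pascal (suc a) (suc b) f = begin
  ((a + suc b) C a) * f (a + suc b) + ((suc (a + b)) C suc a) * f (suc (a + b))
    ≡⟨ cong (λ n → (n C a) * f n + (suc (a + b) C suc a) * f (suc (a + b))) (+-suc a b) ⟩
  (suc (a + b) C a) * f (suc (a + b)) + (suc (a + b) C suc a) * f (suc (a + b))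
    ≡⟨ *-distribʳ-+ (f (suc (a + b))) (suc (a + b) C a) (suc (a + b) C suc a) ⟨
  ((suc (a + b) C a) + (suc (a + b) C suc a)) * f (suc (a + b))
    ≡⟨ cong (_* f (suc (a + b))) (nCk+nC[k+1]≡[n+1]C[k+1] (suc (a + b)) a) ⟩
  (suc (suc (a + b)) C suc a) * f (suc (a + b))
    ≡⟨ cong (λ n → (suc n C suc a) * f n) (+-suc a b) ⟨
  ((suc a + suc b) C suc a) * onPred (suc a + suc b) f ∎
  where open ≡-Reasoning

-- parityPatterns v i j p: the number of ways to declare i positions of v even and j positions odd
-- so that the entries of v in the odd positions sum to parity p.
parityPatterns : ∀ {n} → Vec ℤ₄ n → ℕ → ℕ → Parity → ℕ
parityPatterns []ᵛ       (suc i) j       p  = 0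
parityPatterns []ᵛ       zero    (suc j) p  = 0
parityPatterns []ᵛ       zero    zero    0ℙ = 1
parityPatterns []ᵛ       zero    zero    1ℙ = 0
parityPatterns (x ∷ᵛ v) i       j       p  =
  onPred i (λ i′ → parityPatterns v i′ j p) + onPred j (λ j′ → parityPatterns v i j′ (parity (toℕ x) ℙ.+ p))

parityPatterns-total : ∀ {n} (v : Vec ℤ₄ n) i j → i + j ≡ n →
  parityPatterns v i j 0ℙ + parityPatterns v i j 1ℙ ≡ n C j
parityPatterns-total []ᵛ       zero zero refl = refl
parityPatterns-total {suc n} (x ∷ᵛ v) i j i+j≡1+n = by-parity (parity (toℕ x))
  where
  E : ℕ → Parity → ℕ
  E i p = onPred i (λ i′ → parityPatterns v i′ j p)
  O : ℕ → Parity → ℕ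
  O j p = onPred j (λ j′ → parityPatterns v i j′ p)
  evens : ∀ i → i + j ≡ suc n → E i 0ℙ + E i 1ℙ ≡ n C j
  evens zero    refl = sym (k>n⇒nCk≡0 (n<1+n n))
  evens (suc i) eq   = parityPatterns-total v i j (suc-injective eq)
  odds : ∀ j → i + j ≡ suc n → O j 0ℙ + O j 1ℙ ≡ onPred j (n C_)
  odds zero    eq = refl
  odds (suc j) eq = parityPatterns-total v i j (suc-injective (trans (sym (+-suc i j)) eq))
  pascal′ : ∀ j → (n C j) + onPred j (n C_) ≡ suc n C j
  pascal′ zero    = refl
  pascal′ (suc j) = trans (+-comm (n C suc j) (n C j)) (nCk+nC[k+1]≡[n+1]C[k+1] n j)
  interchange : ∀ a b c d → (a + b) + (c + d) ≡ (a + c) + (b + d)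
  interchange = ℕ-solve-∀
  by-parity : ∀ q → (E i 0ℙ + O j (q ℙ.+ 0ℙ)) + (E i 1ℙ + O j (q ℙ.+ 1ℙ)) ≡ suc n C j
  by-parity 0ℙ = trans (interchange (E i 0ℙ) (O j 0ℙ) (E i 1ℙ) (O j 1ℙ))
    (trans (cong₂ _+_ (evens i i+j≡1+n) (odds j i+j≡1+n)) (pascal′ j))
  by-parity 1ℙ = trans (interchange (E i 0ℙ) (O j 1ℙ) (E i 1ℙ) (O j 0ℙ))
    (trans (cong₂ _+_ (evens i i+j≡1+n) (trans (+-comm (O j 1ℙ) (O j 0ℙ)) (odds j i+j≡1+n))) (pascal′ j))

evenEntries oddEntries : ∀ {n} → Vec ℤ₄ n → ℕ
evenEntries v = typeCount 0 v + typeCount 2 v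
oddEntries  v = typeCount 1 v + typeCount 3 v

entries-total : ∀ {n} (v : Vec ℤ₄ n) → oddEntries v + evenEntries v ≡ n
entries-total []ᵛ        = refl
entries-total (0F ∷ᵛ v) = trans (+-suc (oddEntries v) (evenEntries v)) (cong suc (entries-total v))
entries-total (1F ∷ᵛ v) = cong suc (entries-total v)
entries-total (2F ∷ᵛ v) = trans (cong (_+_ (oddEntries v)) (+-suc (typeCount 0 v) (typeCount 2 v)))
  (trans (+-suc (oddEntries v) (evenEntries v)) (cong suc (entries-total v)))
entries-total (3F ∷ᵛ v) =
  trans (cong (_+ evenEntries v) (+-suc (typeCount 1 v) (typeCount 3 v))) (cong suc (entries-total v))

parityPatterns-signed : ∀ {n} (v : Vec ℤ₄ n) i j → i + j ≡ n →
  + parityPatterns v i j 0ℙ -ℤ + parityPatterns v i j 1ℙ ≡ krawtchouk (oddEntries v) (evenEntries v) j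
parityPatterns-signed []ᵛ            zero zero refl = refl
parityPatterns-signed {suc n} (x ∷ᵛ v) i j i+j≡1+n = by-head x
  where
  m = oddEntries v
  a = evenEntries v
  E : ℕ → Parity → ℕ
  E i p = onPred i (λ i′ → parityPatterns v i′ j p)
  O : ℕ → Parity → ℕ
  O j p = onPred j (λ j′ → parityPatterns v i j′ p)
  evens : ∀ i → i + j ≡ suc n → + E i 0ℙ -ℤ + E i 1ℙ ≡ krawtchouk m a j
  evens zero    refl = sym (krawtchouk-vanish m a (suc n) (s≤s (≤-reflexive (entries-total v))))
  evens (suc i) eq   = parityPatterns-signed v i j (suc-injective eq)
  odds : ∀ j → i + j ≡ suc n → + O j 0ℙ -ℤ + O j 1ℙ ≡ yShift (krawtchouk m a) j
  odds zero    eq = refl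
  odds (suc j) eq = parityPatterns-signed v i j (suc-injective (trans (sym (+-suc i j)) eq))
  split : ∀ e₀ o₀ e₁ o₁ → + (e₀ + o₀) -ℤ + (e₁ + o₁) ≡ (+ e₀ -ℤ + e₁) +ℤ (+ o₀ -ℤ + o₁)
  split e₀ o₀ e₁ o₁ =
    trans (cong₂ _-ℤ_ (ℤ.pos-+ e₀ o₀) (ℤ.pos-+ e₁ o₁)) (regroup (+ e₀) (+ o₀) (+ e₁) (+ o₁))
    where
    regroup : ∀ e₀ o₀ e₁ o₁ → (e₀ +ℤ o₀) -ℤ (e₁ +ℤ o₁) ≡ (e₀ -ℤ e₁) +ℤ (o₀ -ℤ o₁)
    regroup = solve-∀
  split′ : ∀ e₀ o₁ e₁ o₀ → + (e₀ + o₁) -ℤ + (e₁ + o₀) ≡ (+ e₀ -ℤ + e₁) -ℤ (+ o₀ -ℤ + o₁)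
  split′ e₀ o₁ e₁ o₀ =
    trans (cong₂ _-ℤ_ (ℤ.pos-+ e₀ o₁) (ℤ.pos-+ e₁ o₀)) (regroup (+ e₀) (+ o₁) (+ e₁) (+ o₀))
    where
    regroup : ∀ e₀ o₁ e₁ o₀ → (e₀ +ℤ o₁) -ℤ (e₁ +ℤ o₀) ≡ (e₀ -ℤ e₁) -ℤ (o₀ -ℤ o₁)
    regroup = solve-∀
  even-step : + (E i 0ℙ + O j 0ℙ) -ℤ + (E i 1ℙ + O j 1ℙ) ≡ krawtchouk m (suc a) j
  even-step = trans (split (E i 0ℙ) (O j 0ℙ) (E i 1ℙ) (O j 1ℙ))
    (trans (cong₂ _+ℤ_ (evens i i+j≡1+n) (odds j i+j≡1+n)) (sym (krawtchouk-suc-plus m a j)))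
  odd-step : + (E i 0ℙ + O j 1ℙ) -ℤ + (E i 1ℙ + O j 0ℙ) ≡ krawtchouk (suc m) a j
  odd-step = trans (split′ (E i 0ℙ) (O j 1ℙ) (E i 1ℙ) (O j 0ℙ))
    (trans (cong₂ _-ℤ_ (evens i i+j≡1+n) (odds j i+j≡1+n)) (sym (krawtchouk-suc-minus m a j)))
  by-head : ∀ y → + parityPatterns (y ∷ᵛ v) i j 0ℙ -ℤ + parityPatterns (y ∷ᵛ v) i j 1ℙ
                    ≡ krawtchouk (oddEntries (y ∷ᵛ v)) (evenEntries (y ∷ᵛ v)) j
  by-head 0F = even-step
  by-head 1F = odd-step
  by-head 2F = trans even-step (cong (λ a′ → krawtchouk m a′ j) (sym (+-suc (typeCount 0 v) (typeCount 2 v))))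
  by-head 3F = trans odd-step (cong (λ m′ → krawtchouk m′ a j) (sym (+-suc (typeCount 1 v) (typeCount 3 v))))

parityPatterns-even-formula : ∀ {n} (v : Vec ℤ₄ n) i j → i + j ≡ n →
  + (2 * parityPatterns v i j 0ℙ * (n C evenEntries v))
    ≡ + (n C i) *ℤ (+ (n C oddEntries v) +ℤ krawtchouk j i (oddEntries v))
parityPatterns-even-formula {n} v i j i+j≡n = begin
  + (2 * parityPatterns v i j 0ℙ * (n C a))
    ≡⟨ trans (ℤ.pos-* (2 * parityPatterns v i j 0ℙ) (n C a))
             (cong (_*ℤ + (n C a)) (ℤ.pos-* 2 (parityPatterns v i j 0ℙ))) ⟩
  + 2 *ℤ E₀ *ℤ + (n C a)
    ≡⟨ cong (λ k → + 2 *ℤ E₀ *ℤ + k) (C-sym {a} {m} (trans (+-comm a m) (entries-total v))) ⟩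
  + 2 *ℤ E₀ *ℤ c
    ≡⟨ expand E₀ E₁ c ⟩
  (E₀ +ℤ E₁) *ℤ c +ℤ c *ℤ (E₀ -ℤ E₁)
    ≡⟨ cong₂ (λ t d → t *ℤ c +ℤ c *ℤ d) total (parityPatterns-signed v i j i+j≡n) ⟩
  + (n C j) *ℤ c +ℤ c *ℤ krawtchouk m a j
    ≡⟨ cong (+ (n C j) *ℤ c +ℤ_) (krawtchouk-reciprocity {m} {a} {j} {i} (entries-total v) j+i≡n) ⟩
  + (n C j) *ℤ c +ℤ + (n C j) *ℤ krawtchouk j i m
    ≡⟨ ℤ.*-distribˡ-+ (+ (n C j)) c (krawtchouk j i m) ⟨
  + (n C j) *ℤ (c +ℤ krawtchouk j i m)
    ≡⟨ cong (λ k → + k *ℤ (c +ℤ krawtchouk j i m)) (C-sym {j} {i} j+i≡n) ⟩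
  + (n C i) *ℤ (c +ℤ krawtchouk j i m) ∎
  where
  open ≡-Reasoning
  m = oddEntries v
  a = evenEntries v
  c = + (n C m)
  E₀ = + parityPatterns v i j 0ℙ
  E₁ = + parityPatterns v i j 1ℙ
  j+i≡n = trans (+-comm j i) i+j≡n
  total : E₀ +ℤ E₁ ≡ + (n C j)
  total = trans (sym (ℤ.pos-+ (parityPatterns v i j 0ℙ) (parityPatterns v i j 1ℙ)))
                (cong +_ (parityPatterns-total v i j i+j≡n))
  expand : ∀ e₀ e₁ c → + 2 *ℤ e₀ *ℤ c ≡ (e₀ +ℤ e₁) *ℤ c +ℤ c *ℤ (e₀ -ℤ e₁)
  expand = solve-∀

-- Vectors of a given type with even dot product

*-zeroʳ² : ∀ A B → A * (B * 0) ≡ 0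
*-zeroʳ² A B = trans (cong (A *_) (*-zeroʳ B)) (*-zeroʳ A)

-- The offset e is the part of the dot product contributed by coordinates already split off.
typedEven : ∀ {n} → Vec ℤ₄ n → ℕ → ℕ → ℕ → ℕ → ℕ → Vec ℤ₄ n → Bool
typedEven v c₀ c₁ c₂ c₃ e b = hasType c₀ c₁ c₂ c₃ b ∧ isEven (e + b ⊙ v)

module _ {n} (v : Vec ℤ₄ n) (x : ℤ₄) where

  count-offset : ∀ (H : Vec ℤ₄ n → Bool) e d →
    count (λ b → H b ∧ isEven (e + (d + b ⊙ v))) ≡ count (λ b → H b ∧ isEven (e + d + b ⊙ v))
  count-offset H e d = count-cong λ b → cong (λ s → H b ∧ isEven s) (sym (+-assoc e d (b ⊙ v)))

  count-head-excluded : ∀ h c₀ c₁ c₂ c₃ e → (∀ b → hasType c₀ c₁ c₂ c₃ (h ∷ᵛ b) ≡ false) →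
    count (typedEven (x ∷ᵛ v) c₀ c₁ c₂ c₃ e ∘ (h ∷ᵛ_)) ≡ 0
  count-head-excluded h c₀ c₁ c₂ c₃ e =
    count-∧-false (λ b → hasType c₀ c₁ c₂ c₃ (h ∷ᵛ b)) (λ b → isEven (e + (h ∷ᵛ b) ⊙ (x ∷ᵛ v)))

  count-head₀ : ∀ c₀ c₁ c₂ c₃ e → count (typedEven (x ∷ᵛ v) c₀ c₁ c₂ c₃ e ∘ (0F ∷ᵛ_))
                                  ≡ onPred c₀ λ c → count (typedEven v c c₁ c₂ c₃ (e + 0 * toℕ x))
  count-head₀ zero    c₁ c₂ c₃ e = count-head-excluded 0F 0 c₁ c₂ c₃ e λ _ → refl
  count-head₀ (suc c) c₁ c₂ c₃ e = count-offset (hasType c c₁ c₂ c₃) e (0 * toℕ x)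

  count-head₁ : ∀ c₀ c₁ c₂ c₃ e → count (typedEven (x ∷ᵛ v) c₀ c₁ c₂ c₃ e ∘ (1F ∷ᵛ_))
                                  ≡ onPred c₁ λ c → count (typedEven v c₀ c c₂ c₃ (e + 1 * toℕ x))
  count-head₁ c₀ zero    c₂ c₃ e = count-head-excluded 1F c₀ 0 c₂ c₃ e λ b → ∧-zeroʳ (typeCount 0 b ≡ᵇ c₀)
  count-head₁ c₀ (suc c) c₂ c₃ e = count-offset (hasType c₀ c c₂ c₃) e (1 * toℕ x)

  count-head₂ : ∀ c₀ c₁ c₂ c₃ e → count (typedEven (x ∷ᵛ v) c₀ c₁ c₂ c₃ e ∘ (2F ∷ᵛ_))
                                  ≡ onPred c₂ λ c → count (typedEven v c₀ c₁ c c₃ (e + 2 * toℕ x))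
  count-head₂ c₀ c₁ zero    c₃ e = count-head-excluded 2F c₀ c₁ 0 c₃ e λ b →
    trans (cong ((typeCount 0 b ≡ᵇ c₀) ∧_) (∧-zeroʳ (typeCount 1 b ≡ᵇ c₁))) (∧-zeroʳ _)
  count-head₂ c₀ c₁ (suc c) c₃ e = count-offset (hasType c₀ c₁ c c₃) e (2 * toℕ x)

  count-head₃ : ∀ c₀ c₁ c₂ c₃ e → count (typedEven (x ∷ᵛ v) c₀ c₁ c₂ c₃ e ∘ (3F ∷ᵛ_))
                                  ≡ onPred c₃ λ c → count (typedEven v c₀ c₁ c₂ c (e + 3 * toℕ x))
  count-head₃ c₀ c₁ c₂ zero    e = count-head-excluded 3F c₀ c₁ c₂ 0 e λ b →
    trans (cong (λ t → (typeCount 0 b ≡ᵇ c₀) ∧ ((typeCount 1 b ≡ᵇ c₁) ∧ t)) (∧-zeroʳ (typeCount 2 b ≡ᵇ c₂)))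
      (trans (cong ((typeCount 0 b ≡ᵇ c₀) ∧_) (∧-zeroʳ (typeCount 1 b ≡ᵇ c₁))) (∧-zeroʳ _))
  count-head₃ c₀ c₁ c₂ (suc c) e = count-offset (hasType c₀ c₁ c₂ c) e (3 * toℕ x)

typedPatterns : ∀ {n} → Vec ℤ₄ n → ℕ → ℕ → ℕ → ℕ → Parity → ℕ
typedPatterns v c₀ c₁ c₂ c₃ p = ((c₀ + c₂) C c₀) * (((c₁ + c₃) C c₁) * parityPatterns v (c₀ + c₂) (c₁ + c₃) p)

module TypedEvenCons {n} (v : Vec ℤ₄ n) (x : ℤ₄) (c₀ c₁ c₂ c₃ e : ℕ)
  (ih : ∀ c₀ c₁ c₂ c₃ e → count (typedEven v c₀ c₁ c₂ c₃ e) ≡ typedPatterns v c₀ c₁ c₂ c₃ (parity e)) where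

  i o : ℕ
  i = c₀ + c₂
  o = c₁ + c₃

  p q : Parity
  p = parity e
  q = parity (toℕ x)

  headCount : ℤ₄ → ℕ
  headCount h = count (typedEven (x ∷ᵛ v) c₀ c₁ c₂ c₃ e ∘ (h ∷ᵛ_))

  tail-count : ∀ (h : ℤ₄) c₀ c₁ c₂ c₃ →
    count (typedEven v c₀ c₁ c₂ c₃ (e + toℕ h * toℕ x))
      ≡ typedPatterns v c₀ c₁ c₂ c₃ (parity (toℕ h) ℙ.* q ℙ.+ p)
  tail-count h c₀ c₁ c₂ c₃ =
    trans (ih c₀ c₁ c₂ c₃ (e + toℕ h * toℕ x))
          (cong (typedPatterns v c₀ c₁ c₂ c₃) (parity-offset e (toℕ h) (toℕ x)))

  even-heads :
    headCount 0F + headCount 2F ≡ (i C c₀) * ((o C c₁) * onPred i (λ i′ → parityPatterns v i′ o p))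
  even-heads = begin
    headCount 0F + headCount 2F
      ≡⟨ cong₂ _+_ (trans (count-head₀ v x c₀ c₁ c₂ c₃ e) (onPred-cong c₀ λ c → tail-count 0F c c₁ c₂ c₃))
                   (trans (count-head₂ v x c₀ c₁ c₂ c₃ e) (onPred-cong c₂ λ c → tail-count 2F c₀ c₁ c c₃)) ⟩
    onPred c₀ (λ c → ((c + c₂) C c) * f (c + c₂)) + onPred c₂ (λ c → ((c₀ + c) C c₀) * f (c₀ + c))
      ≡⟨ onPred-pascal c₀ c₂ f ⟩
    (i C c₀) * onPred i f
      ≡⟨ cong ((i C c₀) *_) (onPred-*ˡ i (o C c₁) _) ⟩
    (i C c₀) * ((o C c₁) * onPred i (λ i′ → parityPatterns v i′ o p)) ∎
    where
    open ≡-Reasoning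
    f : ℕ → ℕ
    f i′ = (o C c₁) * parityPatterns v i′ o p

  odd-heads :
    headCount 1F + headCount 3F ≡ (i C c₀) * ((o C c₁) * onPred o (λ o′ → parityPatterns v i o′ (q ℙ.+ p)))
  odd-heads = begin
    headCount 1F + headCount 3F
      ≡⟨ cong₂ _+_ (trans (count-head₁ v x c₀ c₁ c₂ c₃ e) (onPred-cong c₁ λ c → tail-count 1F c₀ c c₂ c₃))
                   (trans (count-head₃ v x c₀ c₁ c₂ c₃ e) (onPred-cong c₃ λ c → tail-count 3F c₀ c₁ c₂ c)) ⟩
    onPred c₁ (λ c → (i C c₀) * g₁ c) + onPred c₃ (λ c → (i C c₀) * g₃ c)
      ≡⟨ cong₂ _+_ (onPred-*ˡ c₁ (i C c₀) g₁) (onPred-*ˡ c₃ (i C c₀) g₃) ⟩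
    (i C c₀) * onPred c₁ g₁ + (i C c₀) * onPred c₃ g₃
      ≡⟨ *-distribˡ-+ (i C c₀) (onPred c₁ g₁) (onPred c₃ g₃) ⟨
    (i C c₀) * (onPred c₁ g₁ + onPred c₃ g₃)
      ≡⟨ cong ((i C c₀) *_) (onPred-pascal c₁ c₃ g) ⟩
    (i C c₀) * ((o C c₁) * onPred o g) ∎
    where
    open ≡-Reasoning
    g g₁ g₃ : ℕ → ℕ
    g o′ = parityPatterns v i o′ (q ℙ.+ p)
    g₁ c = ((c + c₃) C c) * g (c + c₃)
    g₃ c = ((c₁ + c) C c₁) * g (c₁ + c)

-- Only the parity pattern of b matters; within it the even positions split as c₀ zeros and c₂ twos,
-- and the odd positions as c₁ ones and c₃ threes.
count-typedEven : ∀ {n} (v : Vec ℤ₄ n) c₀ c₁ c₂ c₃ e →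
  count (typedEven v c₀ c₁ c₂ c₃ e) ≡ typedPatterns v c₀ c₁ c₂ c₃ (parity e)
count-typedEven []ᵛ zero zero zero zero e rewrite +-identityʳ e with parity e
... | 0ℙ = refl
... | 1ℙ = refl
count-typedEven []ᵛ (suc c₀) c₁       c₂       c₃       e =
  sym (*-zeroʳ² ((suc c₀ + c₂) C suc c₀) ((c₁ + c₃) C c₁))
count-typedEven []ᵛ zero      (suc c₁) zero     c₃       e =
  sym (*-zeroʳ² (0 C 0) ((suc c₁ + c₃) C suc c₁))
count-typedEven []ᵛ zero      (suc c₁) (suc c₂) c₃       e =
  sym (*-zeroʳ² (suc c₂ C 0) ((suc c₁ + c₃) C suc c₁))
count-typedEven []ᵛ zero      zero     (suc c₂) c₃       e = sym (*-zeroʳ² (suc c₂ C 0) (c₃ C 0))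
count-typedEven []ᵛ zero      zero     zero     (suc c₃) e = refl
count-typedEven (x ∷ᵛ v) c₀ c₁ c₂ c₃ e = begin
  count (typedEven (x ∷ᵛ v) c₀ c₁ c₂ c₃ e)
    ≡⟨ count-∷ (typedEven (x ∷ᵛ v) c₀ c₁ c₂ c₃ e) ⟩
  headCount 0F + (headCount 1F + (headCount 2F + (headCount 3F + 0)))
    ≡⟨ regroup (headCount 0F) (headCount 1F) (headCount 2F) (headCount 3F) ⟩
  (headCount 0F + headCount 2F) + (headCount 1F + headCount 3F)
    ≡⟨ cong₂ _+_ even-heads odd-heads ⟩
  (i C c₀) * ((o C c₁) * Ev) + (i C c₀) * ((o C c₁) * Od)
    ≡⟨ factor (i C c₀) (o C c₁) Ev Od ⟩
  typedPatterns (x ∷ᵛ v) c₀ c₁ c₂ c₃ p ∎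
  where
  open ≡-Reasoning
  open TypedEvenCons v x c₀ c₁ c₂ c₃ e (count-typedEven v)
  Ev = onPred i (λ i′ → parityPatterns v i′ o p)
  Od = onPred o (λ o′ → parityPatterns v i o′ (q ℙ.+ p))
  regroup : ∀ t₀ t₁ t₂ t₃ → t₀ + (t₁ + (t₂ + (t₃ + 0))) ≡ (t₀ + t₂) + (t₁ + t₃)
  regroup = ℕ-solve-∀
  factor : ∀ A B E O → A * (B * E) + A * (B * O) ≡ A * (B * (E + O))
  factor = ℕ-solve-∀

β-count : ∀ r s {n} (v : Vec ℤ₄ n) → β r s v ≡ count (typedEven v r s r s 0)
β-count r s v = count-cong λ b → cong (hasType r s r s b ∧_) (isEven-%4 (b ⊙ v))

double-sum : ∀ r s → 2 * (r + s) ≡ (r + r) + (s + s)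
double-sum = ℕ-solve-∀

multinom-binomials : ∀ r s →
  multinom (2 * (r + s)) r s ≡ ((2 * (r + s)) C (r + r)) * (((r + r) C r) * ((s + s) C s))
multinom-binomials r s =
  trans (cong (λ k → (k / D) {{nonZero}}) N!≡M*D) (m*n/n≡m M D {{nonZero}})
  where
  D = r ! * s ! * r ! * s !
  M = ((2 * (r + s)) C (r + r)) * (((r + r) C r) * ((s + s) C s))
  nonZero : NonZero D
  nonZero = m*n≢0 _ _ {{m*n≢0 _ _ {{r !* s !≢0}} {{r !≢0}}}} {{s !≢0}}
  N!≡M*D : (2 * (r + s)) ! ≡ M * D
  N!≡M*D = trans (sym (multinomial r r s s (double-sum r s))) (cong (M *_) (reorder (r !) (s !)))
    where
    reorder : ∀ R S → R * R * (S * S) ≡ R * S * R * S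
    reorder = ℕ-solve-∀

lemma5 : (r s : ℕ) → 2 ≤ 2 * (r + s) → (v : Vec ℤ₄ (2 * (r + s))) →
    (+ (2 * β r s v * ((2 * (r + s)) C (typeCount 0 v + typeCount 2 v))))
    ≡ (+ multinom (2 * (r + s)) r s)
    *ℤ coeff (twiceP (2 * (r + s)) r s) (typeCount 0 v + typeCount 2 v) (typeCount 1 v + typeCount 3 v)
lemma5 r s _ v = begin
  + (2 * β r s v * (N C a))                 ≡⟨ cong +_ β-split ⟩
  + (B * (2 * E₀ * (N C a)))                ≡⟨ ℤ.pos-* B _ ⟩
  + B *ℤ + (2 * E₀ * (N C a))               ≡⟨ cong (+ B *ℤ_) (parityPatterns-even-formula v R S R+S≡N) ⟩
  + B *ℤ (+ (N C R) *ℤ (+ (N C m) +ℤ K))    ≡⟨ swap (+ B) (+ (N C R)) (+ (N C m) +ℤ K) ⟩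
  + (N C R) *ℤ + B *ℤ (+ (N C m) +ℤ K)      ≡⟨ cong₂ _*ℤ_ multinom≡ (twiceP-coeffs r s a m a+m≡N) ⟨
  + multinom N r s *ℤ coeff (twiceP N r s) a m ∎
  where
  open ≡-Reasoning
  N = 2 * (r + s)
  R = r + r
  S = s + s
  a = evenEntries v
  m = oddEntries v
  B = (R C r) * (S C s)
  E₀ = parityPatterns v R S 0ℙ
  K = krawtchouk S R m
  R+S≡N = sym (double-sum r s)
  a+m≡N = trans (+-comm a m) (entries-total v)
  β-split : 2 * β r s v * (N C a) ≡ B * (2 * E₀ * (N C a))
  β-split = trans (cong (λ k → 2 * k * (N C a)) (trans (β-count r s v) (count-typedEven v r s r s 0)))
                  (regroup (R C r) (S C s) E₀ (N C a))
    where
    regroup : ∀ x y e c → 2 * (x * (y * e)) * c ≡ x * y * (2 * e * c)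
    regroup = ℕ-solve-∀
  multinom≡ : + multinom N r s ≡ + (N C R) *ℤ + B
  multinom≡ = trans (cong +_ (multinom-binomials r s)) (ℤ.pos-* (N C R) B)
  swap : ∀ x y z → x *ℤ (y *ℤ z) ≡ y *ℤ x *ℤ z
  swap = solve-∀
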